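{- Let $R=(V,A)$ be a connected digraph (request graph) for which a tree solution $\mathcal T$ exists. Let $W$ and $W'$ be two closed walks of $R$ and let $S$ be the set of vertices belonging to both $W$ and $W'$. Then $\mathcal T_\downarrow[S]$ is connected.
   Context: A temporal graph is a pair $\mathcal G=(V,\mathcal E)$ where $\mathcal E$ is a finite set of (distinct) temporal edges $(\{u,v\},t)$ with $u\neq v\in V$ and $t$ a positive integer. A journey from $u_0$ to $u_k$ is a sequence $(u_0,u_1,t_0),\dots,(u_{k-1},u_k,t_{k-1})$ with each $(\{u_i,u_{i+1}\},t_i)\in\mathcal E$ and $t_0<\dots<t_{k-1}$. The footprint $\mathcal G_\downarrow$ is the undirected graph on $V$ with edge set $\{\{u,v\}:(\{u,v\},t)\in\mathcal E\text{ for some }t\}$. A solution for $R=(V,A)$ is a temporal graph on $V$ with a journey from $u$ to $v$ for every arc $(u,v)\in A$. For connected $R$ (underlying undirected graph connected), a tree solution is a solution with exactly $n-1$ temporal edges ($n=|V|$), so that its footprint is a tree. A closed walk of a digraph is a sequence $(u_0,\dots,u_k)$, $k\geq1$, with $(u_i,u_{i+1})$ an arc for all $i$ and $u_k=u_0$. $G[S]$ denotes the induced subgraph on $S$. -}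

module Defs where

open import Data.Nat using (ℕ; _<_; _∸_; _≤_)
open import Data.Fin using (Fin; toℕ)
open import Data.Product using (Σ; _×_; _,_; ∃)
open import Data.Sum using (_⊎_)
open import Data.List using (List; []; _∷_; length)
open import Data.List.Membership.Propositional using (_∈_)
open import Data.List.Relation.Unary.All using (All)
open import Data.List.Relation.Unary.Unique.Propositional using (Unique)
open import Relation.Binary.Construct.Closure.ReflexiveTransitive using (Star)
open import Relation.Binary.Construct.Closure.Symmetric using (SymClosure)
open import Relation.Binary.PropositionalEquality using (_≡_)

Digraph : ℕ → Set₁
Digraph n = Fin n → Fin n → Set

Connected : ∀ {n} → Digraph n → Set
Connected {n} A = ∀ (u v : Fin n) → Star (SymClosure A) u v

-- A temporal edge ({u,v},t) is stored as (u , v , t) with toℕ u < toℕ v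
-- (canonical orientation, so that distinct triples = distinct temporal edges)
-- and t positive.
TEdge : ℕ → Set
TEdge n = Fin n × Fin n × ℕ

ValidTEdge : ∀ {n} → TEdge n → Set
ValidTEdge (u , v , t) = toℕ u < toℕ v × 1 ≤ t

record TemporalGraph (n : ℕ) : Set where
  field
    edges  : List (TEdge n)
    valid  : All ValidTEdge edges
    unique : Unique edges
open TemporalGraph public

HasEdge : ∀ {n} → TemporalGraph n → Fin n → Fin n → ℕ → Set
HasEdge G u w t = ((u , w , t) ∈ edges G) ⊎ ((w , u , t) ∈ edges G)

-- JourneyAfter G t u v : a journey from u to v all of whose times are > t,
-- with strictly increasing times.
data JourneyAfter {n} (G : TemporalGraph n) : ℕ → Fin n → Fin n → Set where
  done : ∀ {t u} → JourneyAfter G t u u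
  step : ∀ {t t' u w v} → HasEdge G u w t' → t < t' →
         JourneyAfter G t' w v → JourneyAfter G t u v

-- Journey from u to v (times are positive, so the bound 0 is no constraint).
Journey : ∀ {n} → TemporalGraph n → Fin n → Fin n → Set
Journey G u v = JourneyAfter G 0 u v

IsSolution : ∀ {n} → Digraph n → TemporalGraph n → Set
IsSolution {n} A G = ∀ (u v : Fin n) → A u v → Journey G u v

IsTreeSolution : ∀ {n} → Digraph n → TemporalGraph n → Set
IsTreeSolution {n} A G = IsSolution A G × length (edges G) ≡ (n ∸ 1)

FootAdj : ∀ {n} → TemporalGraph n → Fin n → Fin n → Set
FootAdj G u w = ∃ λ t → HasEdge G u w t

data WalkSeq {n} (A : Digraph n) : Fin n → Fin n → List (Fin n) → Set where
  stop : ∀ {x} → WalkSeq A x x (x ∷ [])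
  next : ∀ {x y z vs} → A x y → WalkSeq A y z vs → WalkSeq A x z (x ∷ vs)

-- Closed walk (u_0,...,u_k), k ≥ 1, u_k = u_0, given as its vertex list
ClosedWalk : ∀ {n} → Digraph n → List (Fin n) → Set
ClosedWalk {n} A vs = Σ (Fin n) (λ x → WalkSeq A x x vs × 2 ≤ length vs)

InducedConnected : ∀ {n} → TemporalGraph n → (Fin n → Set) → Set
InducedConnected {n} G S =
  ∀ (u v : Fin n) → S u → S v →
    Star (λ a b → S a × S b × FootAdj G a b) u v

{-# OPTIONS --safe #-}

-- Counting edges shows that the footprint of a tree solution is a tree, so every
-- temporal edge is a bridge of it.  Fix x outside a closed walk W.  Each component
-- of T − x hangs off x by a single link, whose time we call the branch time of the
-- component.  A journey realising an arc of W that passes through x enters x from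
-- the component of its source and leaves it into that of its target strictly later,
-- so along W branch times never decrease and increase at every change of
-- component; as W is closed, W lies in one component of T − x.  Now let P be a
-- footprint path between two vertices of S = W ∩ W'.  If P leaves S at x, say
-- x ∉ W, then both neighbours of x on P lie in the component of T − x containing W,
-- hence they coincide, and P can be shortened.  A shortest path therefore stays in S.

module Submission where

open import Defs
open import Data.Nat using (ℕ; zero; suc; _∸_; _≤_; _<_; z≤n; s≤s)
open import Data.Nat.Properties
  using (≤-reflexive; ≤-trans; <-trans; <-irrefl; <⇒≤; n<1+n; m<n⇒m<1+n; n≮n; module ≤-Reasoning)
open import Data.Nat.Induction using (<-wellFounded)
open import Induction.WellFounded using (Acc; acc)
open import Data.Fin as Fin using (Fin; punchIn; punchOut; _≟_)
open import Data.Fin.Properties using (punchOut-cong; punchOut-punchIn; punchInᵢ≢i)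
open import Data.List using (List; length; map)
open import Data.List.Properties using (length-map; length-removeAt′)
open import Data.List.Relation.Unary.Any using (here; there; index)
open import Data.List.Relation.Unary.All as All using (All; []; _∷_)
open import Data.List.Membership.Propositional using (_∈_; _∉_; _─_)
open import Data.List.Membership.Propositional.Properties using (∈-map⁺)
open import Data.Product using (∃; ∃₂; Σ; _×_; _,_; proj₁; proj₂)
open import Data.Sum as Sum using (_⊎_; inj₁; inj₂; swap; [_,_]′)
open import Data.Empty using (⊥-elim)
open import Function using (_∘_; id)
open import Level using (0ℓ)
open import Relation.Nullary using (¬_; yes; no)
open import Relation.Nullary.Decidable using (_×-dec_)
open import Relation.Unary using (Pred; Decidable)
open import Relation.Binary using (Rel; _⇒_)
open import Relation.Binary.PropositionalEquality
  using (_≡_; _≢_; refl; sym; trans; cong; subst; subst₂; module ≡-Reasoning)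
open import Relation.Binary.Construct.Closure.ReflexiveTransitive as Star
  using (Star; ε; _◅_; _◅◅_; reverse; kleisliStar)
open import Relation.Binary.Construct.Closure.Symmetric using (SymClosure; fwd; bwd)

private variable
  n m : ℕ
  s t t' tp tq : ℕ
  u v w x y y' z p q : Fin n
  E : List (TEdge n)

steps : ∀ {I : Set} {R : Rel I 0ℓ} {i j} → Star R i j → ℕ
steps ε       = 0
steps (_ ◅ P) = suc (steps P)

steps-map : ∀ {I : Set} {R S : Rel I 0ℓ} {i j} (f : R ⇒ S) (P : Star R i j) →
            steps (Star.map f P) ≡ steps P
steps-map f ε       = refl
steps-map f (_ ◅ P) = cong suc (steps-map f P)

∈⇒≡⊎∈-─ : ∀ {A : Set} {x y : A} {xs} (x∈xs : x ∈ xs) → y ∈ xs → y ≡ x ⊎ y ∈ xs ─ x∈xs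
∈⇒≡⊎∈-─ (here refl)  (here refl)  = inj₁ refl
∈⇒≡⊎∈-─ (here refl)  (there y∈xs) = inj₂ y∈xs
∈⇒≡⊎∈-─ (there x∈xs) (here refl)  = inj₂ (here refl)
∈⇒≡⊎∈-─ (there x∈xs) (there y∈xs) = Sum.map₂ there (∈⇒≡⊎∈-─ x∈xs y∈xs)

∉⇒≢ : ∀ {A : Set} {x z : A} {xs} → x ∉ xs → z ∈ xs → z ≢ x
∉⇒≢ x∉xs z∈xs refl = x∉xs z∈xs

proper-step : ∀ {R : Rel (Fin n) 0ℓ} → Star R u v → u ≢ v → ∃₂ λ a b → a ≢ b × R a b
proper-step ε u≢u = ⊥-elim (u≢u refl)
proper-step {u = u} (_◅_ {j = w} r P) u≢v with u ≟ w
... | yes refl = proper-step P u≢v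
... | no u≢w   = u , w , u≢w , r

-- HasEdge T and FootAdj T unfold to Link (edges T) and Adjacent (edges T).

Link : List (TEdge n) → Fin n → Fin n → ℕ → Set
Link E u w t = ((u , w , t) ∈ E) ⊎ ((w , u , t) ∈ E)

Adjacent : List (TEdge n) → Rel (Fin n) 0ℓ
Adjacent E u w = ∃ (Link E u w)

adjacent-sym : Adjacent E u w → Adjacent E w u
adjacent-sym (t , ℓ) = t , swap ℓ

Connects : List (TEdge n) → Set
Connects {n} E = ∀ (u v : Fin n) → Star (Adjacent E) u v

Acyclic : List (TEdge n) → Set
Acyclic E = ∀ {a b t} (e∈E : (a , b , t) ∈ E) → ¬ Star (Adjacent (E ─ e∈E)) a b

Avoiding : List (TEdge n) → Fin n → Rel (Fin n) 0ℓ
Avoiding E x u w = u ≢ x × w ≢ x × Adjacent E u w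

avoiding-sym : Avoiding E x u w → Avoiding E x w u
avoiding-sym (u≢x , w≢x , u~w) = w≢x , u≢x , adjacent-sym u~w

Induced : List (TEdge n) → Pred (Fin n) 0ℓ → Rel (Fin n) 0ℓ
Induced E S u w = S u × S w × Adjacent E u w

Unseparated : List (TEdge n) → Pred (Fin n) 0ℓ → Set
Unseparated E S = ∀ {x u v} → ¬ S x → S u → S v → Star (Avoiding E x) u v

link-─ : ∀ {e} (e∈E : e ∈ E) → Link E u w t →
         Link (E ─ e∈E) u w t ⊎ ((u , w , t) ≡ e ⊎ (w , u , t) ≡ e)
link-─ e∈E (inj₁ ℓ) = [ inj₂ ∘ inj₁ , inj₁ ∘ inj₁ ]′ (∈⇒≡⊎∈-─ e∈E ℓ)
link-─ e∈E (inj₂ ℓ) = [ inj₂ ∘ inj₂ , inj₁ ∘ inj₂ ]′ (∈⇒≡⊎∈-─ e∈E ℓ)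

-- Contracting the edge ab identifies b with a; punchOut then renumbers.
module Merge {a b : Fin (suc m)} (b≢a : b ≢ a) where

  merge : Fin (suc m) → Fin m
  merge z with z ≟ b
  ... | yes _   = punchOut b≢a
  ... | no z≢b  = punchOut (z≢b ∘ sym)

  merge-a≡merge-b : merge a ≡ merge b
  merge-a≡merge-b with a ≟ b | b ≟ b
  ... | yes a≡b | _       = ⊥-elim (b≢a (sym a≡b))
  ... | no _    | yes _   = punchOut-cong b refl
  ... | no _    | no b≢b  = ⊥-elim (b≢b refl)

  merge-punchIn : ∀ w → merge (punchIn b w) ≡ w
  merge-punchIn w with punchIn b w ≟ b
  ... | yes eq = ⊥-elim (punchInᵢ≢i b w eq)
  ... | no _   = trans (punchOut-cong b refl) (punchOut-punchIn b)

  mergeEdge : TEdge (suc m) → TEdge m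
  mergeEdge (p , q , t) = merge p , merge q , t

  merge-connects : ∀ {E : List (TEdge (suc m))} (ab∈E : (a , b , t) ∈ E) →
                   Connects E → Connects (map mergeEdge (E ─ ab∈E))
  merge-connects {E = E} ab∈E connects u v =
    subst₂ (Star _) (merge-punchIn u) (merge-punchIn v)
      (kleisliStar merge merge-step (connects (punchIn b u) (punchIn b v)))
    where
    merge-step : Adjacent E p q → Star (Adjacent (map mergeEdge (E ─ ab∈E))) (merge p) (merge q)
    merge-step (s , ℓ) with link-─ ab∈E ℓ
    ... | inj₁ ℓ'          = (s , Sum.map (∈-map⁺ mergeEdge) (∈-map⁺ mergeEdge) ℓ') ◅ ε
    ... | inj₂ (inj₁ refl) = subst (Star _ (merge a)) merge-a≡merge-b ε
    ... | inj₂ (inj₂ refl) = subst (Star _ (merge b)) (sym merge-a≡merge-b) ε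

nonloop-edge : ∀ {E : List (TEdge (suc (suc m)))} → Connects E →
               ∃₂ λ a b → ∃ λ t → b ≢ a × (a , b , t) ∈ E
nonloop-edge connects with proper-step (connects Fin.zero (Fin.suc Fin.zero)) (λ ())
... | a , b , a≢b , t , inj₁ ab∈E = a , b , t , a≢b ∘ sym , ab∈E
... | a , b , a≢b , t , inj₂ ba∈E = b , a , t , a≢b , ba∈E

contract-edge : ∀ {E : List (TEdge (suc (suc m)))} → Connects E →
                ∃ λ (E' : List (TEdge (suc m))) → Connects E' × length E ≡ suc (length E')
contract-edge {E = E} connects with nonloop-edge connects
... | a , b , t , b≢a , ab∈E =
  map mergeEdge (E ─ ab∈E) , merge-connects ab∈E connects , (begin
    length E                                 ≡⟨ length-removeAt′ E (index ab∈E) ⟩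
    suc (length (E ─ ab∈E))                  ≡⟨ cong suc (length-map mergeEdge (E ─ ab∈E)) ⟨
    suc (length (map mergeEdge (E ─ ab∈E)))  ∎)
  where open Merge b≢a
        open ≡-Reasoning

connects⇒n∸1≤length : ∀ {n} {E : List (TEdge n)} → Connects E → n ∸ 1 ≤ length E
connects⇒n∸1≤length {zero}        _ = z≤n
connects⇒n∸1≤length {suc zero}    _ = z≤n
connects⇒n∸1≤length {suc (suc m)} connects =
  let _ , connects′ , length≡ = contract-edge connects
  in  subst (suc m ≤_) (sym length≡) (s≤s (connects⇒n∸1≤length connects′))

connects∧length≡n∸1⇒acyclic : ∀ {n} {E : List (TEdge n)} → Connects E → length E ≡ n ∸ 1 → Acyclic E
connects∧length≡n∸1⇒acyclic {n} {E} connects length≡ ab∈E cycle =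
  n≮n (length (E ─ ab∈E)) (begin-strict
    length (E ─ ab∈E)        <⟨ n<1+n _ ⟩
    suc (length (E ─ ab∈E))  ≡⟨ length-removeAt′ E (index ab∈E) ⟨
    length E                 ≡⟨ length≡ ⟩
    n ∸ 1                    ≤⟨ connects⇒n∸1≤length (λ u v → kleisliStar id reroute (connects u v)) ⟩
    length (E ─ ab∈E)        ∎)
  where
  open ≤-Reasoning
  reroute : Adjacent E p q → Star (Adjacent (E ─ ab∈E)) p q
  reroute (s , ℓ) with link-─ ab∈E ℓ
  ... | inj₁ ℓ'          = (s , ℓ') ◅ ε
  ... | inj₂ (inj₁ refl) = cycle
  ... | inj₂ (inj₂ refl) = reverse adjacent-sym cycle

avoiding⇒adjacent-─ : ∀ {a b} (e∈E : (a , b , t) ∈ E) → x ≡ a ⊎ x ≡ b →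
                      Avoiding E x u w → Adjacent (E ─ e∈E) u w
avoiding⇒adjacent-─ e∈E x∈e (u≢x , w≢x , s , ℓ) with link-─ e∈E ℓ
... | inj₁ ℓ'          = s , ℓ'
... | inj₂ (inj₁ refl) = ⊥-elim ([ u≢x ∘ sym , w≢x ∘ sym ]′ x∈e)
... | inj₂ (inj₂ refl) = ⊥-elim ([ w≢x ∘ sym , u≢x ∘ sym ]′ x∈e)

acyclic⇒link-unique : Acyclic E → Link E x y t → Link E x y' t' →
                      Star (Avoiding E x) y y' → y ≡ y' × t ≡ t'
acyclic⇒link-unique acyclic (inj₁ xy∈E) ℓ' path with link-─ xy∈E ℓ'
... | inj₁ ℓ'' = ⊥-elim (acyclic xy∈E
        ((_ , ℓ'') ◅ reverse adjacent-sym (Star.map (avoiding⇒adjacent-─ xy∈E (inj₁ refl)) path)))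
... | inj₂ (inj₁ refl) = refl , refl
... | inj₂ (inj₂ refl) = refl , refl
acyclic⇒link-unique acyclic (inj₂ yx∈E) ℓ' path with link-─ yx∈E ℓ'
... | inj₁ ℓ'' = ⊥-elim (acyclic yx∈E
        (Star.map (avoiding⇒adjacent-─ yx∈E (inj₂ refl)) path ◅◅ (_ , swap ℓ'') ◅ ε))
... | inj₂ (inj₁ refl) = refl , refl
... | inj₂ (inj₂ refl) = refl , refl

last-exit : (P : Star (Adjacent E) w v) → v ≢ x →
            (w ≢ x × Σ (Star (Avoiding E x) w v) λ Q → steps Q ≡ steps P) ⊎
            (∃ λ y → Adjacent E x y × Σ (Star (Avoiding E x) y v) λ Q → steps Q < steps P)
last-exit ε v≢x = inj₁ (v≢x , ε , refl)
last-exit {w = w} {x = x} (_◅_ {j = w'} w~w' P) v≢x with last-exit P v≢x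
... | inj₂ (y , x~y , Q , Q<P) = inj₂ (y , x~y , Q , m<n⇒m<1+n Q<P)
... | inj₁ (w'≢x , Q , Q≡P) with w ≟ x
...   | yes refl = inj₂ (w' , w~w' , Q , s≤s (≤-reflexive Q≡P))
...   | no w≢x   = inj₁ (w≢x , (w≢x , w'≢x , w~w') ◅ Q , cong suc Q≡P)

unseparated⇒induced-connected : ∀ {S : Pred (Fin n) 0ℓ} → Acyclic E → Decidable S →
  Unseparated E S → S u → S v → Star (Adjacent E) u v → Star (Induced E S) u v
unseparated⇒induced-connected {E = E} {v = v} {S = S} acyclic S? unseparated su sv P =
  shorten P su (<-wellFounded (steps P))
  where
  shorten : (P : Star (Adjacent E) u v) → S u → Acc _<_ (steps P) → Star (Induced E S) u v
  shorten ε _ _ = ε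
  shorten (_◅_ {j = x} u~x P) su (acc shorter) with S? x
  ... | yes sx = (su , sx , u~x) ◅ shorten P sx (shorter (n<1+n _))
  ... | no ¬sx with last-exit P (λ v≡x → ¬sx (subst S v≡x sv))
  ...   | inj₁ (x≢x , _) = ⊥-elim (x≢x refl)
  ...   | inj₂ (y , (_ , x~y) , Q , Q<P)
          with acyclic⇒link-unique acyclic (swap (proj₂ u~x)) x~y
                 (unseparated ¬sx su sv ◅◅ reverse avoiding-sym Q)
  ...     | refl , _ = shorten (Star.map (proj₂ ∘ proj₂) Q) su
                         (shorter (subst (_< _) (sym (steps-map _ Q)) (m<n⇒m<1+n Q<P)))

journey⇒path : ∀ {T : TemporalGraph n} → JourneyAfter T s u v → Star (Adjacent (edges T)) u v
journey⇒path done          = ε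
journey⇒path (step ℓ _ J) = (_ , ℓ) ◅ journey⇒path J

solution-connects : ∀ {A : Digraph n} {T : TemporalGraph n} →
                    Connected A → IsSolution A T → Connects (edges T)
solution-connects {A = A} {T = T} connected solves u v = kleisliStar id arc-path (connected u v)
  where
  arc-path : SymClosure A p q → Star (Adjacent (edges T)) p q
  arc-path (fwd arc) = journey⇒path (solves _ _ arc)
  arc-path (bwd arc) = reverse adjacent-sym (journey⇒path (solves _ _ arc))

Branch : List (TEdge n) → Fin n → Fin n → ℕ → Set
Branch E x z t = ∃ λ y → Link E x y t × Star (Avoiding E x) y z

branch-unique : Acyclic E → Branch E x z t → Branch E x z t' → t ≡ t'
branch-unique acyclic (_ , ℓ , P) (_ , ℓ' , P') =
  proj₂ (acyclic⇒link-unique acyclic ℓ ℓ' (P ◅◅ reverse avoiding-sym P'))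

branch-extend : Branch E x z t → Star (Avoiding E x) z w → Branch E x w t
branch-extend (y , ℓ , P) Q = y , ℓ , P ◅◅ Q

branch-exists : Connects E → z ≢ x → ∃ (Branch E x z)
branch-exists {z = z} {x = x} connects z≢x with last-exit (connects x z) z≢x
... | inj₁ (x≢x , _)              = ⊥-elim (x≢x refl)
... | inj₂ (y , (t , ℓ) , Q , _) = t , y , ℓ , Q

module _ {T : TemporalGraph n} where

  journey-last-exit : JourneyAfter T s w q → q ≢ x →
    (w ≢ x × Star (Avoiding (edges T) x) w q) ⊎ ∃ λ b → s < b × Branch (edges T) x q b
  journey-last-exit done q≢x = inj₁ (q≢x , ε)
  journey-last-exit {w = w} {x = x} (step {t' = t} {w = w'} ℓ s<t J) q≢x
    with journey-last-exit J q≢x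
  ... | inj₂ (b , t<b , branch) = inj₂ (b , <-trans s<t t<b , branch)
  ... | inj₁ (w'≢x , Q) with w ≟ x
  ...   | yes refl = inj₂ (t , s<t , w' , ℓ , Q)
  ...   | no w≢x   = inj₁ (w≢x , (w≢x , w'≢x , t , ℓ) ◅ Q)

  journey-through : JourneyAfter T s p q → p ≢ x → q ≢ x →
    Star (Avoiding (edges T) x) p q ⊎
    ∃₂ λ a b → a < b × Branch (edges T) x p a × Branch (edges T) x q b
  journey-through done _ _ = inj₁ ε
  journey-through {x = x} (step {w = w} ℓ _ J) p≢x q≢x with w ≟ x
  ... | no w≢x with journey-through J w≢x q≢x
  ...   | inj₁ Q = inj₁ ((p≢x , w≢x , _ , ℓ) ◅ Q)
  ...   | inj₂ (a , b , a<b , branch-w , branch-q) =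
          inj₂ (a , b , a<b , branch-extend branch-w ((w≢x , p≢x , _ , swap ℓ) ◅ ε) , branch-q)
  journey-through {p = p} (step {t' = t} ℓ _ J) p≢x q≢x | yes refl with journey-last-exit J q≢x
  ...   | inj₁ (x≢x , _)          = ⊥-elim (x≢x refl)
  ...   | inj₂ (b , t<b , branch) = inj₂ (t , b , t<b , (p , swap ℓ , ε) , branch)

walk-head∈ : ∀ {A : Digraph n} {vs} → WalkSeq A y z vs → y ∈ vs
walk-head∈ stop       = here refl
walk-head∈ (next _ _) = here refl

module _ {A : Digraph n} {T : TemporalGraph n} (solves : IsSolution A T) (acyclic : Acyclic (edges T)) where

  walk-branch-≤ : ∀ {vs} → WalkSeq A p q vs → x ∉ vs →
    Branch (edges T) x p tp → Branch (edges T) x q tq →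
    tp ≤ tq × (tp ≡ tq → All (Star (Avoiding (edges T) x) p) vs)
  walk-branch-≤ stop x∉vs bp bq = ≤-reflexive (branch-unique acyclic bp bq) , λ _ → ε ∷ []
  walk-branch-≤ {tp = tp} {tq = tq} (next arc walk) x∉vs bp bq
    with journey-through (solves _ _ arc) (∉⇒≢ x∉vs (here refl)) (∉⇒≢ x∉vs (there (walk-head∈ walk)))
  ... | inj₁ Q =
    let tp≤tq , joined = walk-branch-≤ walk (x∉vs ∘ there) (branch-extend bp Q) bq
    in tp≤tq , λ tp≡tq → ε ∷ All.map (Q ◅◅_) (joined tp≡tq)
  ... | inj₂ (a , b , a<b , ba , bb) = <⇒≤ tp<tq , λ tp≡tq → ⊥-elim (<-irrefl tp≡tq tp<tq)
    where
    tp<tq : tp < tq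
    tp<tq = subst (_< _) (branch-unique acyclic ba bp)
                  (≤-trans a<b (proj₁ (walk-branch-≤ walk (x∉vs ∘ there) bb bq)))

  closed-walk-joined : ∀ {W} → Connects (edges T) → ClosedWalk A W → x ∉ W →
                       u ∈ W → v ∈ W → Star (Avoiding (edges T) x) u v
  closed-walk-joined {x = x} {W = W} connects (x₀ , walk , _) x∉W u∈W v∈W =
    reverse avoiding-sym (All.lookup joined u∈W) ◅◅ All.lookup joined v∈W
    where
    joined : All (Star (Avoiding (edges T) x) x₀) W
    joined = let _ , branch = branch-exists connects (∉⇒≢ x∉W (walk-head∈ walk))
             in  proj₂ (walk-branch-≤ walk x∉W branch branch) refl

corollary4p2 : ∀ {n : ℕ} (A : Digraph n) (T : TemporalGraph n) →
    Connected A → IsTreeSolution A T →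
    (W W' : List (Fin n)) → ClosedWalk A W → ClosedWalk A W' →
    InducedConnected T (λ x → (x ∈ W) × (x ∈ W'))
corollary4p2 {n} A T connected (solves , length≡) W W' closed closed' u v su sv =
  unseparated⇒induced-connected acyclic (λ z → z ∈? W ×-dec z ∈? W') unseparated su sv (connects u v)
  where
  open import Data.List.Membership.DecPropositional (_≟_ {n}) using (_∈?_)

  connects : Connects (edges T)
  connects = solution-connects connected solves
  acyclic : Acyclic (edges T)
  acyclic = connects∧length≡n∸1⇒acyclic connects length≡

  unseparated : Unseparated (edges T) (λ x → (x ∈ W) × (x ∈ W'))
  unseparated {x} x∉S (u∈W , u∈W') (v∈W , v∈W') with x ∈? W
  ... | yes x∈W = closed-walk-joined solves acyclic connects closed' (x∉S ∘ (x∈W ,_)) u∈W' v∈W'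
  ... | no x∉W  = closed-walk-joined solves acyclic connects closed x∉W u∈W v∈W
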